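{- Let $G$ be a finite group of order $d$, $\nu=\sum_{\sigma\in G}\sigma$ and $\bar\nu=\sum_{\sigma\in G}(1-\sigma)=d-\nu$ in $\mathbb Z_\ell[G]$. Let $(M_n)_n$ be a family of finite $\mathbb Z_\ell[G]$-modules whose $\mathbb Z_\ell$-rank (minimal number of generators as $\mathbb Z_\ell$-modules) is bounded independently of $n$. Then ${}_\nu M_n\sim M_n^{\bar\nu}$ and ${}_{\bar\nu}M_n\sim M_n^{\nu}$, where ${}_\nu M$ denotes the kernel of $\nu$ on $M$ and $M^{\bar\nu}$ the image of $\bar\nu$ (similarly for the other pair).
   Context: Two families of finite modules $A_n,B_n$ depending on a parameter $n$ are called equivalent, written $A_n\sim B_n$, when $v_\ell(|A_n|/|B_n|)$ is bounded independently of $n$ ($v_\ell$ the $\ell$-adic valuation). -}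

module Defs where

open import Data.Nat using (ℕ; zero; suc; _+_; _*_; _^_; _≤_)
open import Data.Nat.Divisibility using (_∣_)
open import Data.Nat.Primality using (Prime)
open import Data.Fin using (Fin) renaming (zero to fzero; suc to fsuc)
import Data.Fin.Properties as FinP
open import Data.List using (List; length; filter)
open import Data.List using () renaming (allFin to listAllFin)
open import Data.Product using (Σ; ∃; _×_; _,_)
open import Relation.Nullary using (¬_)
open import Relation.Binary.PropositionalEquality using (_≡_)
import Algebra.Structures as AS

-- A finite group of order d, realised on the carrier Fin d with
-- propositional equality (every finite group of order d is isomorphic
-- to one of this form).
record FinGroup (d : ℕ) : Set where
  field
    _∙_     : Fin d → Fin d → Fin d
    ε       : Fin d
    _⁻¹     : Fin d → Fin d
    isGroup : AS.IsGroup {A = Fin d} _≡_ _∙_ ε _⁻¹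

sumFin : {A : Set} → (A → A → A) → A → (k : ℕ) → (Fin k → A) → A
sumFin _⊕_ o zero    f = o
sumFin _⊕_ o (suc k) f = f fzero ⊕ sumFin _⊕_ o k (λ i → f (fsuc i))

mulN : {A : Set} → (A → A → A) → A → ℕ → A → A
mulN _⊕_ o zero    x = o
mulN _⊕_ o (suc k) x = x ⊕ mulN _⊕_ o k x

-- A finite Z_ℓ[G]-module: a finite abelian ℓ-group (i.e. a finite
-- Z_ℓ-module) on the carrier Fin N, with a Z-linear left action of G.
record FinModule (ℓ d : ℕ) (G : FinGroup d) : Set where
  open FinGroup G
  field
    N              : ℕ
    _⊕_            : Fin N → Fin N → Fin N
    0#             : Fin N
    ⊖_             : Fin N → Fin N
    isAbelianGroup : AS.IsAbelianGroup {A = Fin N} _≡_ _⊕_ 0# ⊖_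
    ℓ-torsion      : ∀ (x : Fin N) → ∃ λ k → mulN _⊕_ 0# (ℓ ^ k) x ≡ 0#
    act            : Fin d → Fin N → Fin N
    act-ε          : ∀ x → act ε x ≡ x
    act-∙          : ∀ g h x → act (g ∙ h) x ≡ act g (act h x)
    act-+          : ∀ g x y → act g (x ⊕ y) ≡ act g x ⊕ act g y

  ν : Fin N → Fin N
  ν x = sumFin _⊕_ 0# d (λ σ → act σ x)

  ν̄ : Fin N → Fin N
  ν̄ x = sumFin _⊕_ 0# d (λ σ → x ⊕ (⊖ act σ x))

  -- Generated as an abelian group (equivalently as a Z_ℓ-module) by r elements.
  GeneratedBy : ℕ → Set
  GeneratedBy r = Σ (Fin r → Fin N) λ gens →
    ∀ (x : Fin N) → ∃ λ (c : Fin r → ℕ) →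
      sumFin _⊕_ 0# r (λ i → mulN _⊕_ 0# (c i) (gens i)) ≡ x

  kerCard : (Fin N → Fin N) → ℕ
  kerCard f = length (filter (λ x → f x FinP.≟ 0#) (listAllFin N))

  imCard : (Fin N → Fin N) → ℕ
  imCard f = length (filter (λ y → FinP.any? (λ x → f x FinP.≟ y)) (listAllFin N))

IsVal : ℕ → ℕ → ℕ → Set
IsVal ℓ a k = (ℓ ^ k ∣ a) × ¬ (ℓ ^ suc k ∣ a)

-- Equivalence of families: v_ℓ(a n / b n) = v_ℓ(a n) - v_ℓ(b n) bounded in n.
_∼⟨_⟩_ : (ℕ → ℕ) → ℕ → (ℕ → ℕ) → Set
a ∼⟨ ℓ ⟩ b = ∃ λ C → ∀ n i j → IsVal ℓ (a n) i → IsVal ℓ (b n) j →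
  (i ≤ j + C) × (j ≤ i + C)

{-# OPTIONS --safe #-}

-- Write d·_ for multiplication by d = |G|. Since ν̄ = d − ν and σν = ν for every σ ∈ G, the
-- composites νν̄ and ν̄ν vanish, d·ker ν ⊆ im ν̄ and d·ker ν̄ ⊆ im ν. Now let α, β be
-- endomorphisms of a finite abelian group M with βα = 0 and d·ker β ⊆ im α. By Lagrange
-- |ker β| = |im α|·q, and |ker β| = |d·ker β|·|ker β ∩ M[d]| ≤ |im α|·|M[d]| gives q ≤ |M[d]|.
-- If M has r generators, the d^r combinations with coefficients below d meet every coset of
-- dM, so |M[d]| = |M/dM| ≤ d^r. Finally v_ℓ(q) < q, so the valuations differ by at most d^r.
module Submission where

open import Defs
open import Level using (0ℓ)
open import Algebra.Bundles using (Group; AbelianGroup; CommutativeMonoid)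
open import Algebra.Structures using (IsGroup; IsAbelianGroup)
open import Data.Bool.Base using (true; false; if_then_else_)
open import Data.Fin.Base as Fin using (Fin; zero; suc; toℕ; fromℕ<; finToFun; funToFin)
import Data.Fin.Properties as Finₚ
open import Data.Fin.Properties using (_≟_; any?)
open import Data.Fin.Permutation using (Permutation; _⟨$⟩ʳ_; permutation)
open import Data.List.Base using (length; filter; tabulate; allFin)
open import Data.Nat.Base as ℕ using (ℕ; zero; suc; _+_; _*_; _^_; _∸_; z≤n; s≤s; NonZero; >-nonZero)
import Data.Nat.Properties as ℕₚ
open import Data.Nat.Divisibility
  using (_∣_; divides; ∣-trans; _∣0; 1∣_; m∣m*n; *-monoʳ-∣; *-monoˡ-∣; *-cancelˡ-∣; ∣⇒≤)
open import Data.Nat.DivMod using (_%_; _/_; m%n<n; m≡m%n+[m/n]*n)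
open import Data.Nat.Primality using (Prime; euclidsLemma; prime⇒nonZero; prime⇒nonTrivial)
open import Data.Product.Base using (∃; _×_; _,_; proj₁; proj₂)
open import Data.Sum.Base using (inj₁; inj₂)
open import Data.Unit.Base using (tt)
open import Function.Base using (_∘_; const)
open import Relation.Nullary using (Dec; yes; no; does; ¬_; contradiction)
open import Relation.Nullary.Decidable using (_×-dec_)
open import Relation.Unary using (Pred; Decidable; _⊆_; _≐_; U)
open import Relation.Unary.Properties using (U?; ∅?; _∩?_)
open import Relation.Binary.PropositionalEquality
  using (_≡_; refl; sym; trans; cong; cong₂; subst; subst₂; module ≡-Reasoning)

private variable
  n m k : ℕ

module Counting where
  open import Algebra.Properties.Semiring.Sum ℕₚ.+-*-semiring

  private variable
    P Q : Pred (Fin n) 0ℓ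

  indicator : {A : Set} → Dec A → ℕ
  indicator a? = if does a? then 1 else 0

  count : {n : ℕ} {P : Pred (Fin n) 0ℓ} → Decidable P → ℕ
  count {n} P? = ∑[ x < n ] indicator (P? x)

  sum-mono-≤ : {f g : Fin n → ℕ} → (∀ i → f i ℕ.≤ g i) → sum f ℕ.≤ sum g
  sum-mono-≤ {zero}  f≤g = z≤n
  sum-mono-≤ {suc n} f≤g = ℕₚ.+-mono-≤ (f≤g zero) (sum-mono-≤ (f≤g ∘ suc))

  term-≤-sum : (f : Fin n → ℕ) (i : Fin n) → f i ℕ.≤ sum f
  term-≤-sum f zero    = ℕₚ.m≤m+n (f zero) _
  term-≤-sum f (suc i) = ℕₚ.≤-trans (term-≤-sum (f ∘ suc) i) (ℕₚ.m≤n+m _ (f zero))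

  indicator-mono : {A B : Set} → (A → B) → (a? : Dec A) (b? : Dec B) → indicator a? ℕ.≤ indicator b?
  indicator-mono A→B (yes a) (yes _) = ℕₚ.≤-refl
  indicator-mono A→B (yes a) (no ¬b) = contradiction (A→B a) ¬b
  indicator-mono A→B (no _)  _       = z≤n

  indicator-×-dec : {A B : Set} (a? : Dec A) (b? : Dec B) →
                    indicator (a? ×-dec b?) ≡ indicator a? * indicator b?
  indicator-×-dec (yes _) (yes _) = refl
  indicator-×-dec (yes _) (no _)  = refl
  indicator-×-dec (no _)  _       = refl

  count-mono : P ⊆ Q → (P? : Decidable P) (Q? : Decidable Q) → count P? ℕ.≤ count Q?
  count-mono P⊆Q P? Q? = sum-mono-≤ (λ x → indicator-mono P⊆Q (P? x) (Q? x))

  count-cong : P ≐ Q → (P? : Decidable P) (Q? : Decidable Q) → count P? ≡ count Q?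
  count-cong (P⊆Q , Q⊆P) P? Q? = ℕₚ.≤-antisym (count-mono P⊆Q P? Q?) (count-mono Q⊆P Q? P?)

  count-pos : (P? : Decidable P) {x : Fin n} → P x → 0 ℕ.< count P?
  count-pos P? {x} px =
    ℕₚ.≤-trans (indicator-mono (const px) (yes tt) (P? x)) (term-≤-sum (indicator ∘ P?) x)

  count-∅ : {n : ℕ} {P : Pred (Fin n) 0ℓ} (P? : Decidable P) → (∀ x → ¬ P x) → count P? ≡ 0
  count-∅ {n} P? ¬P = ℕₚ.n≤0⇒n≡0
    (ℕₚ.≤-trans (count-mono (λ {x} → ¬P x) P? ∅?) (ℕₚ.≤-reflexive (sum-replicate-zero n)))

  count-U : count (U? {A = Fin n}) ≡ n
  count-U {zero}  = refl
  count-U {suc n} = cong suc (count-U {n})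

  count-singleton : (a : Fin n) → count (a ≟_) ≡ 1
  count-singleton {suc n} zero    = cong suc (count-∅ {n} ((zero ≟_) ∘ suc) (λ _ ()))
  count-singleton (suc a) = count-singleton a

  count-permute : (π : Permutation n n) (P? : Decidable P) → count (P? ∘ (π ⟨$⟩ʳ_)) ≡ count P?
  count-permute π P? = sym (sum-permute (indicator ∘ P?) π)

  fibre? : {S : Pred (Fin n) 0ℓ} → Decidable S → (f : Fin n → Fin m) (y : Fin m) →
           Decidable (λ x → S x × f x ≡ y)
  fibre? S? f y x = S? x ×-dec (f x ≟ y)

  imageOn? : {S : Pred (Fin n) 0ℓ} → Decidable S → (f : Fin n → Fin m) →
             Decidable (λ y → ∃ λ x → S x × f x ≡ y)
  imageOn? S? f y = any? (fibre? S? f y)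

  image? : (f : Fin n → Fin m) → Decidable (λ y → ∃ λ x → f x ≡ y)
  image? f y = any? (λ x → f x ≟ y)

  count-fibres : {S : Pred (Fin n) 0ℓ} (S? : Decidable S) (f : Fin n → Fin m) →
                 count S? ≡ ∑[ y < m ] count (fibre? S? f y)
  count-fibres {n} {m} S? f = trans (sum-cong-≗ split) (∑-comm (λ x y → indicator (fibre? S? f y x)))
    where
    open ≡-Reasoning
    split : ∀ x → indicator (S? x) ≡ ∑[ y < m ] indicator (fibre? S? f y x)
    split x = begin
      indicator (S? x)                                     ≡⟨ sym (ℕₚ.*-identityʳ _) ⟩
      indicator (S? x) * 1                                 ≡⟨ cong (indicator (S? x) *_) (count-singleton (f x)) ⟨
      indicator (S? x) * count (f x ≟_)                    ≡⟨ *-distribˡ-sum (indicator (S? x)) (indicator ∘ (f x ≟_)) ⟩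
      ∑[ y < m ] (indicator (S? x) * indicator (f x ≟ y))  ≡⟨ sum-cong-≗ (indicator-×-dec (S? x) ∘ (f x ≟_)) ⟨
      ∑[ y < m ] indicator (fibre? S? f y x)               ∎

  count≡count-imageOn*fibre : {S : Pred (Fin n) 0ℓ} (S? : Decidable S) (f : Fin n → Fin m) (c : ℕ) →
    (∀ {x} → S x → count (fibre? S? f (f x)) ≡ c) → count S? ≡ count (imageOn? S? f) * c
  count≡count-imageOn*fibre {n} {m} S? f c uniform = begin
    count S?                                      ≡⟨ count-fibres S? f ⟩
    ∑[ y < m ] count (fibre? S? f y)              ≡⟨ sum-cong-≗ fibre-size ⟩
    ∑[ y < m ] (indicator (imageOn? S? f y) * c)  ≡⟨ *-distribʳ-sum c (indicator ∘ imageOn? S? f) ⟨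
    count (imageOn? S? f) * c                     ∎
    where
    open ≡-Reasoning
    fibre-size : ∀ y → count (fibre? S? f y) ≡ indicator (imageOn? S? f y) * c
    fibre-size y with imageOn? S? f y
    ... | yes (x , Sx , refl) = trans (uniform Sx) (sym (ℕₚ.+-identityʳ c))
    ... | no ∄x               = count-∅ (fibre? S? f y) (λ x p → ∄x (x , p))

  count-image≤ : (f : Fin n → Fin m) → count (image? f) ℕ.≤ n
  count-image≤ {n} {m} f = begin
    count (image? f)                  ≤⟨ sum-mono-≤ hit ⟩
    ∑[ y < m ] count (fibre? U? f y)  ≡⟨ count-fibres U? f ⟨
    count (U? {A = Fin n})            ≡⟨ count-U ⟩
    n                                 ∎
    where
    open ℕₚ.≤-Reasoning
    hit : ∀ y → indicator (image? f y) ℕ.≤ count (fibre? U? f y)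
    hit y with image? f y
    ... | yes (x , fx≡y) = count-pos (fibre? U? f y) (tt , fx≡y)
    ... | no _           = z≤n

  length-filter-allFin : {P : Pred (Fin n) 0ℓ} (P? : Decidable P) →
                         length (filter P? (allFin n)) ≡ count P?
  length-filter-allFin {n} P? = length-filter-tabulate n (λ x → x)
    where
    length-filter-tabulate : ∀ k (f : Fin k → Fin n) →
      length (filter P? (tabulate f)) ≡ ∑[ i < k ] indicator (P? (f i))
    length-filter-tabulate zero    f = refl
    length-filter-tabulate (suc k) f with does (P? (f zero))
    ... | true  = cong suc (length-filter-tabulate k (f ∘ suc))
    ... | false = length-filter-tabulate k (f ∘ suc)

open Counting

Least : Pred (Fin n) 0ℓ → Fin n → Set
Least P y = P y × (∀ {z} → P z → y Fin.≤ z)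

least : {P : Pred (Fin n) 0ℓ} → Decidable P → ∀ {x} → P x → ∃ (Least P)
least {suc n} P? {x} Px with P? zero | x
... | yes P0 | _      = zero , P0 , λ _ → z≤n
... | no ¬P0 | zero   = contradiction Px ¬P0
... | no ¬P0 | suc _  with least (P? ∘ suc) Px
...   | y , Py , y-min = suc y , Py , λ { {zero} P0 → contradiction P0 ¬P0 ; {suc z} Pz → s≤s (y-min Pz) }

least-unique : {P Q : Pred (Fin n) 0ℓ} → P ≐ Q → ∀ {y z} → Least P y → Least Q z → y ≡ z
least-unique (P⊆Q , Q⊆P) (Py , y-min) (Qz , z-min) = Finₚ.≤-antisym (y-min (Q⊆P Qz)) (z-min (P⊆Q Py))

module FiniteAbelianGroup {N : ℕ} {_∙_ : Fin N → Fin N → Fin N} {ε : Fin N} {_⁻¹ : Fin N → Fin N}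
  (isAbelianGroup : IsAbelianGroup _≡_ _∙_ ε _⁻¹) where

  abelianGroup : AbelianGroup 0ℓ 0ℓ
  abelianGroup = record { isAbelianGroup = isAbelianGroup }

  open AbelianGroup abelianGroup public
    using (_-_; identityˡ; identityʳ; inverseʳ; commutativeMonoid)
    renaming (_∙_ to _⊕_; ε to 0#; _⁻¹ to ⊖_)
  open AbelianGroup abelianGroup using (assoc; comm)
  open import Algebra.Properties.AbelianGroup abelianGroup public
    using (⁻¹-∙-comm; ⁻¹-anti-homo‿-; //-rightDividesˡ; //-rightDividesʳ; ε⁻¹≈ε;
           identityˡ-unique; inverseʳ-unique; x∙y⁻¹≈ε⇒x≈y)
  open import Algebra.Properties.CommutativeMonoid.Sum commutativeMonoid public
    using (sum; sum-cong-≗; ∑-distrib-+; sum-permute; sum-replicate)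
  open import Algebra.Properties.CommutativeMonoid.Mult commutativeMonoid public
    using (×-homo-+; ×-assocˡ; ×-distrib-+) renaming (_×_ to _·_)
  open import Algebra.Properties.CommutativeSemigroup (CommutativeMonoid.commutativeSemigroup commutativeMonoid)
    using (interchange)

  private variable
    x y z : Fin N
    S H K : Pred (Fin N) 0ℓ

  [x-y]⊕[y-z]≡x-z : ∀ x y z → (x - y) ⊕ (y - z) ≡ x - z
  [x-y]⊕[y-z]≡x-z x y z = trans (sym (assoc (x - y) y (⊖ z))) (cong (_- z) (//-rightDividesˡ y x))

  [x⊕y]-x≡y : ∀ x y → (x ⊕ y) - x ≡ y
  [x⊕y]-x≡y x y = trans (cong (_- x) (comm x y)) (//-rightDividesʳ x y)

  translation : Fin N → Permutation N N
  translation a = permutation (_⊕ a) (_- a) (λ x → //-rightDividesˡ a x) (λ x → //-rightDividesʳ a x)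

  IsHom : (Fin N → Fin N) → Set
  IsHom h = ∀ x y → h (x ⊕ y) ≡ h x ⊕ h y

  module _ {h : Fin N → Fin N} (h-hom : IsHom h) where

    hom-0 : h 0# ≡ 0#
    hom-0 = identityˡ-unique (h 0#) (h 0#) (trans (sym (h-hom 0# 0#)) (cong h (identityˡ 0#)))

    hom-⊖ : ∀ x → h (⊖ x) ≡ ⊖ h x
    hom-⊖ x = inverseʳ-unique (h x) (h (⊖ x)) (trans (sym (h-hom x (⊖ x))) (trans (cong h (inverseʳ x)) hom-0))

    hom-sum : (f : Fin k → Fin N) → h (sum f) ≡ sum (h ∘ f)
    hom-sum {zero}  f = hom-0
    hom-sum {suc k} f = trans (h-hom (f zero) (sum (f ∘ suc))) (cong (h (f zero) ⊕_) (hom-sum (f ∘ suc)))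

    hom-· : ∀ k x → h (k · x) ≡ k · h x
    hom-· zero    x = hom-0
    hom-· (suc k) x = trans (h-hom x (k · x)) (cong (h x ⊕_) (hom-· k x))

  ·-hom : ∀ k → IsHom (k ·_)
  ·-hom k x y = ×-distrib-+ x y k

  ⊖-hom : IsHom ⊖_
  ⊖-hom x y = sym (⁻¹-∙-comm x y)

  difference-hom : ∀ {f g} → IsHom f → IsHom g → IsHom (λ x → f x - g x)
  difference-hom {f} {g} f-hom g-hom x y = begin
    f (x ⊕ y) - g (x ⊕ y)          ≡⟨ cong₂ _-_ (f-hom x y) (g-hom x y) ⟩
    f x ⊕ f y ⊕ ⊖ (g x ⊕ g y)      ≡⟨ cong (f x ⊕ f y ⊕_) (⊖-hom (g x) (g y)) ⟩
    f x ⊕ f y ⊕ (⊖ g x ⊕ ⊖ g y)    ≡⟨ interchange (f x) (f y) (⊖ g x) (⊖ g y) ⟩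
    (f x - g x) ⊕ (f y - g y)      ∎
    where open ≡-Reasoning

  IsHom-≗ : ∀ {f g} → IsHom f → (∀ x → f x ≡ g x) → IsHom g
  IsHom-≗ {f} {g} f-hom f≗g x y =
    trans (sym (f≗g (x ⊕ y))) (trans (f-hom x y) (cong₂ _⊕_ (f≗g x) (f≗g y)))

  record IsSubgroup (H : Pred (Fin N) 0ℓ) : Set where
    field
      ∈-0 : H 0#
      ∈-⊕ : H x → H y → H (x ⊕ y)
      ∈-⊖ : H x → H (⊖ x)

    ∈-- : H x → H y → H (x - y)
    ∈-- Hx Hy = ∈-⊕ Hx (∈-⊖ Hy)

    ∈-cancel : H (x ⊕ y) → H y → H x
    ∈-cancel {x} {y} Hx⊕y Hy = subst H (//-rightDividesʳ y x) (∈-- Hx⊕y Hy)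

  Ker : (Fin N → Fin N) → Pred (Fin N) 0ℓ
  Ker h x = h x ≡ 0#

  ker? : (h : Fin N → Fin N) → Decidable (Ker h)
  ker? h x = h x ≟ 0#

  Im : (Fin N → Fin N) → Pred (Fin N) 0ℓ
  Im h y = ∃ λ x → h x ≡ y

  U-isSubgroup : IsSubgroup U
  U-isSubgroup = record { ∈-0 = tt ; ∈-⊕ = λ _ _ → tt ; ∈-⊖ = λ _ → tt }

  Ker-isSubgroup : ∀ {h} → IsHom h → IsSubgroup (Ker h)
  Ker-isSubgroup {h} h-hom = record
    { ∈-0 = hom-0 h-hom
    ; ∈-⊕ = λ {x} {y} hx hy → trans (h-hom x y) (trans (cong₂ _⊕_ hx hy) (identityˡ 0#))
    ; ∈-⊖ = λ {x} hx → trans (hom-⊖ h-hom x) (trans (cong ⊖_ hx) ε⁻¹≈ε)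
    }

  Im-isSubgroup : ∀ {h} → IsHom h → IsSubgroup (Im h)
  Im-isSubgroup {h} h-hom = record
    { ∈-0 = 0# , hom-0 h-hom
    ; ∈-⊕ = λ { (a , refl) (b , refl) → a ⊕ b , h-hom a b }
    ; ∈-⊖ = λ { (a , refl) → ⊖ a , hom-⊖ h-hom a }
    }

  count-coset-fibration : (S? : Decidable S) (H? : Decidable H) (f : Fin N → Fin m) →
    (∀ {x₀} → S x₀ → (λ x → S (x ⊕ x₀) × f (x ⊕ x₀) ≡ f x₀) ≐ H) →
    count S? ≡ count (imageOn? S? f) * count H?
  count-coset-fibration S? H? f fibre≐H = count≡count-imageOn*fibre S? f (count H?) λ {x₀} Sx₀ →
    trans (sym (count-permute (translation x₀) (fibre? S? f (f x₀))))
          (count-cong (fibre≐H Sx₀) (fibre? S? f (f x₀) ∘ (_⊕ x₀)) H?)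

  count-subgroup≡image*kernel : ∀ {h} → IsHom h → IsSubgroup S → (S? : Decidable S) →
    count S? ≡ count (imageOn? S? h) * count (S? ∩? ker? h)
  count-subgroup≡image*kernel {h = h} h-hom S-sub S? = count-coset-fibration S? (S? ∩? ker? h) h λ Sx₀ →
      (λ (Sx⊕x₀ , hx⊕x₀≡hx₀) → ∈-cancel Sx⊕x₀ Sx₀ , identityˡ-unique _ _ (trans (sym (h-hom _ _)) hx⊕x₀≡hx₀))
    , (λ (Sx , hx≡0) → ∈-⊕ Sx Sx₀ , trans (h-hom _ _) (trans (cong (_⊕ _) hx≡0) (identityˡ _)))
    where open IsSubgroup S-sub

  module Cosets {H : Pred (Fin N) 0ℓ} (H? : Decidable H) (H-sub : IsSubgroup H) where
    open IsSubgroup H-sub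

    _∼_ : Fin N → Fin N → Set
    x ∼ y = H (x - y)

    ∼-refl : x ∼ x
    ∼-refl {x} = subst H (sym (inverseʳ x)) ∈-0

    ∼-sym : x ∼ y → y ∼ x
    ∼-sym {x} {y} x∼y = subst H (⁻¹-anti-homo‿- x y) (∈-⊖ x∼y)

    ∼-trans : x ∼ y → y ∼ z → x ∼ z
    ∼-trans {x} {y} {z} x∼y y∼z = subst H ([x-y]⊕[y-z]≡x-z x y z) (∈-⊕ x∼y y∼z)

    -- Lacking quotient types, a coset is represented by its least element.
    least-in-coset : ∀ x → ∃ (Least (x ∼_))
    least-in-coset x = least (λ y → H? (x - y)) ∼-refl

    coset-min : Fin N → Fin N
    coset-min x = proj₁ (least-in-coset x)

    coset-min-cong : x ∼ y → coset-min x ≡ coset-min y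
    coset-min-cong x∼y = least-unique
      ((λ x∼z → ∼-trans (∼-sym x∼y) x∼z) , (λ y∼z → ∼-trans x∼y y∼z))
      (proj₂ (least-in-coset _)) (proj₂ (least-in-coset _))

    coset-min-injective : coset-min x ≡ coset-min y → x ∼ y
    coset-min-injective {x} {y} eq =
      ∼-trans (proj₁ (proj₂ (least-in-coset x)))
              (∼-sym (subst (y ∼_) (sym eq) (proj₁ (proj₂ (least-in-coset y)))))

    count-subgroup≡index*count : IsSubgroup K → H ⊆ K → (K? : Decidable K) →
      count K? ≡ count (imageOn? K? coset-min) * count H?
    count-subgroup≡index*count K-sub H⊆K K? = count-coset-fibration K? H? coset-min λ {x₀} Kx₀ →
        (λ (_ , eq) → subst H (//-rightDividesʳ x₀ _) (coset-min-injective eq))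
      , (λ {x} Hx → K.∈-⊕ (H⊆K Hx) Kx₀ , coset-min-cong (subst H (sym (//-rightDividesʳ x₀ x)) Hx))
      where module K = IsSubgroup K-sub

    count-U≤#reps*count : (g : Fin k → Fin N) → (∀ x → ∃ λ a → x ∼ g a) →
                          count (U? {A = Fin N}) ℕ.≤ k * count H?
    count-U≤#reps*count {k} g reps = begin
      count (U? {A = Fin N})                        ≡⟨ count-subgroup≡index*count U-isSubgroup _ U? ⟩
      count (imageOn? U? coset-min) * count H?      ≤⟨ ℕₚ.*-monoˡ-≤ (count H?) index≤ ⟩
      k * count H?                                  ∎
      where
      open ℕₚ.≤-Reasoning
      index≤ : count (imageOn? U? coset-min) ℕ.≤ k
      index≤ = ℕₚ.≤-trans
        (count-mono (λ { (x , _ , refl) → let (a , x∼ga) = reps x in a , sym (coset-min-cong x∼ga) })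
                    (imageOn? U? coset-min) (image? (coset-min ∘ g)))
        (count-image≤ (coset-min ∘ g))

  ker-im-index≤torsion : ∀ d {α β} → IsHom α → IsHom β → (∀ x → β (α x) ≡ 0#) →
    (∀ {x} → β x ≡ 0# → ∃ λ y → α y ≡ d · x) →
    ∃ λ q → count (ker? β) ≡ count (image? α) * q × q ℕ.≤ count (ker? (d ·_))
  ker-im-index≤torsion d {α} {β} α-hom β-hom β∘α≡0 d-Ker⊆Im = index , ker≡im*index , index≤torsion
    where
    open Cosets (image? α) (Im-isSubgroup α-hom)
    index = count (imageOn? (ker? β) coset-min)

    ker≡im*index : count (ker? β) ≡ count (image? α) * index
    ker≡im*index = trans
      (count-subgroup≡index*count (Ker-isSubgroup β-hom) (λ { (x , refl) → β∘α≡0 x }) (ker? β))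
      (ℕₚ.*-comm index _)

    ker≤im*torsion : count (ker? β) ℕ.≤ count (image? α) * count (ker? (d ·_))
    ker≤im*torsion = begin
      count (ker? β)
        ≡⟨ count-subgroup≡image*kernel (·-hom d) (Ker-isSubgroup β-hom) (ker? β) ⟩
      count (imageOn? (ker? β) (d ·_)) * count (ker? β ∩? ker? (d ·_))
        ≤⟨ ℕₚ.*-mono-≤ d·Ker≤Im (count-mono proj₂ (ker? β ∩? ker? (d ·_)) (ker? (d ·_))) ⟩
      count (image? α) * count (ker? (d ·_))
        ∎
      where
      open ℕₚ.≤-Reasoning
      d·Ker≤Im : count (imageOn? (ker? β) (d ·_)) ℕ.≤ count (image? α)
      d·Ker≤Im = count-mono (λ { (x , βx≡0 , refl) → d-Ker⊆Im βx≡0 })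
                            (imageOn? (ker? β) (d ·_)) (image? α)

    index≤torsion : index ℕ.≤ count (ker? (d ·_))
    index≤torsion = ℕₚ.*-cancelˡ-≤ (count (image? α)) {{>-nonZero (count-pos (image? α) (0# , hom-0 α-hom))}}
      (ℕₚ.≤-trans (ℕₚ.≤-reflexive (sym ker≡im*index)) ker≤im*torsion)

  sum-·-divMod : ∀ d .{{_ : NonZero d}} (c : Fin k → ℕ) (g : Fin k → Fin N) →
    sum (λ i → c i · g i) ≡ sum (λ i → (c i % d) · g i) ⊕ d · sum (λ i → (c i / d) · g i)
  sum-·-divMod {k} d c g = begin
    sum (λ i → c i · g i)                                             ≡⟨ sum-cong-≗ split ⟩
    sum (λ i → low i ⊕ (d * (c i / d)) · g i)                         ≡⟨ ∑-distrib-+ low (λ i → (d * (c i / d)) · g i) ⟩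
    sum low ⊕ sum (λ i → (d * (c i / d)) · g i)                       ≡⟨ cong (sum low ⊕_) pull-d ⟨
    sum low ⊕ d · sum (λ i → (c i / d) · g i)                         ∎
    where
    open ≡-Reasoning
    low : Fin k → Fin N
    low i = (c i % d) · g i
    split : ∀ i → c i · g i ≡ (c i % d) · g i ⊕ (d * (c i / d)) · g i
    split i = trans (cong (_· g i) (trans (m≡m%n+[m/n]*n (c i) d) (cong (c i % d +_) (ℕₚ.*-comm (c i / d) d))))
                    (×-homo-+ (g i) (c i % d) (d * (c i / d)))
    pull-d : d · sum (λ i → (c i / d) · g i) ≡ sum (λ i → (d * (c i / d)) · g i)
    pull-d = trans (hom-sum (·-hom d) (λ i → (c i / d) · g i)) (sum-cong-≗ (λ i → ×-assocˡ (g i) d (c i / d)))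

  count-torsion≤d^#generators : ∀ d .{{_ : NonZero d}} {r} (gens : Fin r → Fin N) →
    (∀ x → ∃ λ c → sum (λ i → c i · gens i) ≡ x) → count (ker? (d ·_)) ℕ.≤ d ^ r
  count-torsion≤d^#generators d {r} gens spans = ℕₚ.*-cancelˡ-≤ (count (image? (d ·_))) {{>-nonZero dM>0}} (begin
    count (image? (d ·_)) * count (ker? (d ·_))  ≡⟨ all≡dM*torsion ⟨
    count (U? {A = Fin N})                        ≤⟨ count-U≤#reps*count combination reps ⟩
    d ^ r * count (image? (d ·_))                 ≡⟨ ℕₚ.*-comm (d ^ r) _ ⟩
    count (image? (d ·_)) * d ^ r                 ∎)
    where
    open ℕₚ.≤-Reasoning
    open Cosets (image? (d ·_)) (Im-isSubgroup (·-hom d))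

    dM>0 : 0 ℕ.< count (image? (d ·_))
    dM>0 = count-pos (image? (d ·_)) (0# , hom-0 (·-hom d))

    all≡dM*torsion : count (U? {A = Fin N}) ≡ count (image? (d ·_)) * count (ker? (d ·_))
    all≡dM*torsion = trans (count-subgroup≡image*kernel (·-hom d) U-isSubgroup U?)
      (cong₂ _*_ (count-cong ((λ { (x , _ , eq) → x , eq }) , (λ { (x , eq) → x , tt , eq }))
                             (imageOn? U? (d ·_)) (image? (d ·_)))
                 (count-cong (proj₂ , (tt ,_)) (U? ∩? ker? (d ·_)) (ker? (d ·_))))

    combination : Fin (d ^ r) → Fin N
    combination a = sum (λ i → toℕ (finToFun a i) · gens i)

    reps : ∀ x → ∃ λ a → x ∼ combination a
    reps x = a , (sum (λ i → (c i / d) · gens i) , sym x-combination≡)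
      where
      c = proj₁ (spans x)
      a = funToFin (λ i → fromℕ< (m%n<n (c i) d))
      combination≡ : combination a ≡ sum (λ i → (c i % d) · gens i)
      combination≡ = sum-cong-≗ λ i →
        cong (_· gens i) (trans (cong toℕ (Finₚ.finToFun-funToFin _ i)) (Finₚ.toℕ-fromℕ< _))
      x-combination≡ : x - combination a ≡ d · sum (λ i → (c i / d) · gens i)
      x-combination≡ = trans
        (cong₂ _-_ (trans (sym (proj₂ (spans x))) (sum-·-divMod d c gens)) combination≡)
        ([x⊕y]-x≡y _ _)

module Valuation {ℓ : ℕ} (ℓ-prime : Prime ℓ) where
  private instance
    ℓ-nonZero : NonZero ℓ
    ℓ-nonZero = prime⇒nonZero ℓ-prime

  n<ℓ^n : ∀ n → n ℕ.< ℓ ^ n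
  n<ℓ^n zero    = ℕ.z<s
  n<ℓ^n (suc n) = ℕₚ.≤-<-trans (n<ℓ^n n)
    (ℕₚ.^-monoʳ-< ℓ (ℕ.nonTrivial⇒n>1 ℓ {{prime⇒nonTrivial ℓ-prime}}) (ℕₚ.n<1+n n))

  ^-monoʳ-∣ : ∀ {m n} → m ℕ.≤ n → ℓ ^ m ∣ ℓ ^ n
  ^-monoʳ-∣ {m} {n} m≤n = divides (ℓ ^ (n ∸ m))
    (trans (cong (ℓ ^_) (sym (ℕₚ.m∸n+n≡m m≤n))) (ℕₚ.^-distribˡ-+-* ℓ (n ∸ m) m))

  ^∣⇒≤ : ∀ {a k i} → ℓ ^ k ∣ a → ¬ ℓ ^ suc i ∣ a → k ℕ.≤ i
  ^∣⇒≤ {k = k} {i} ℓᵏ∣a ℓⁱ⁺¹∤a with k ℕₚ.≤? i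
  ... | yes k≤i = k≤i
  ... | no  k≰i = contradiction (∣-trans (^-monoʳ-∣ (ℕₚ.≰⇒> k≰i)) ℓᵏ∣a) ℓⁱ⁺¹∤a

  ^∣-coprime : ∀ t {b q} → ¬ ℓ ∣ b → ℓ ^ t ∣ b * q → ℓ ^ t ∣ q
  ^∣-coprime zero    ℓ∤b _ = 1∣ _
  ^∣-coprime (suc t) {b} {q} ℓ∤b ℓᵗ⁺¹∣bq with euclidsLemma b q ℓ-prime (∣-trans (m∣m*n (ℓ ^ t)) ℓᵗ⁺¹∣bq)
  ... | inj₁ ℓ∣b = contradiction ℓ∣b ℓ∤b
  ... | inj₂ (divides q′ refl) = subst (ℓ * ℓ ^ t ∣_) (ℕₚ.*-comm ℓ q′) (*-monoʳ-∣ ℓ ℓᵗ∣q′)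
    where
    ℓᵗ∣q′ : ℓ ^ t ∣ q′
    ℓᵗ∣q′ = ^∣-coprime t ℓ∤b (*-cancelˡ-∣ ℓ (subst (ℓ * ℓ ^ t ∣_)
      (trans (sym (ℕₚ.*-assoc b q′ ℓ)) (ℕₚ.*-comm (b * q′) ℓ)) ℓᵗ⁺¹∣bq))

  isVal-mono-∣ : ∀ {a b i j} → b ∣ a → IsVal ℓ a i → IsVal ℓ b j → j ℕ.≤ i
  isVal-mono-∣ b∣a (_ , ℓⁱ⁺¹∤a) (ℓʲ∣b , _) = ^∣⇒≤ (∣-trans ℓʲ∣b b∣a) ℓⁱ⁺¹∤a

  isVal-*-≤ : ∀ {b q i j} → IsVal ℓ (b * q) i → IsVal ℓ b j → i ℕ.≤ j + q
  isVal-*-≤ {b} {q} {i} {j} vᵢ@(ℓⁱ∣bq , ℓⁱ⁺¹∤bq) vⱼ@(divides b′ b≡b′ℓʲ , ℓʲ⁺¹∤b) =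
    subst (ℕ._≤ j + q) (ℕₚ.m+[n∸m]≡n j≤i) (ℕₚ.+-monoʳ-≤ j t≤q)
    where
    instance
      ℓʲ-nonZero : NonZero (ℓ ^ j)
      ℓʲ-nonZero = ℕₚ.m^n≢0 ℓ j
      q-nonZero : NonZero q
      q-nonZero = ℕ.≢-nonZero λ { refl → ℓⁱ⁺¹∤bq (subst (ℓ ^ suc i ∣_) (sym (ℕₚ.*-zeroʳ b)) (_ ∣0)) }
    j≤i : j ℕ.≤ i
    j≤i = isVal-mono-∣ (divides q (ℕₚ.*-comm b q)) vᵢ vⱼ
    t = i ∸ j
    ℓ∤b′ : ¬ ℓ ∣ b′
    ℓ∤b′ ℓ∣b′ = ℓʲ⁺¹∤b (subst (ℓ * ℓ ^ j ∣_) (sym b≡b′ℓʲ) (*-monoˡ-∣ (ℓ ^ j) ℓ∣b′))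
    ℓᵗ∣q : ℓ ^ t ∣ q
    ℓᵗ∣q = ^∣-coprime t ℓ∤b′ (*-cancelˡ-∣ (ℓ ^ j) (subst₂ _∣_
      (trans (cong (ℓ ^_) (sym (ℕₚ.m+[n∸m]≡n j≤i))) (ℕₚ.^-distribˡ-+-* ℓ j t))
      (trans (cong (_* q) (trans b≡b′ℓʲ (ℕₚ.*-comm b′ (ℓ ^ j)))) (ℕₚ.*-assoc (ℓ ^ j) b′ q))
      ℓⁱ∣bq))
    t≤q : t ℕ.≤ q
    t≤q = ℕₚ.<⇒≤ (ℕₚ.<-≤-trans (n<ℓ^n t) (∣⇒≤ ℓᵗ∣q))

  ∼-of-bounded-cofactor : ∀ {a b : ℕ → ℕ} C → (∀ n → ∃ λ q → a n ≡ b n * q × q ℕ.≤ C) → a ∼⟨ ℓ ⟩ b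
  ∼-of-bounded-cofactor {a} {b} C cofactor = C , bounds
    where
    bounds : ∀ n i j → IsVal ℓ (a n) i → IsVal ℓ (b n) j → (i ℕ.≤ j + C) × (j ℕ.≤ i + C)
    bounds n i j vᵢ vⱼ with cofactor n
    ... | q , aₙ≡bₙq , q≤C =
        ℕₚ.≤-trans (isVal-*-≤ (subst (λ x → IsVal ℓ x i) aₙ≡bₙq vᵢ) vⱼ) (ℕₚ.+-monoʳ-≤ j q≤C)
      , ℕₚ.≤-trans (isVal-mono-∣ (divides q (trans aₙ≡bₙq (ℕₚ.*-comm (b n) q))) vᵢ vⱼ) (ℕₚ.m≤m+n i C)

module GModule {ℓ d : ℕ} {G : FinGroup d} (M : FinModule ℓ d G) where
  open FinGroup G using (_∙_; isGroup)
  open FinModule M using (N; isAbelianGroup; act; act-∙; act-+; ν; ν̄; GeneratedBy; kerCard; imCard)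
  open FiniteAbelianGroup isAbelianGroup
  group : Group 0ℓ 0ℓ
  group = record { isGroup = isGroup }

  open import Algebra.Properties.Group group
    using (\\-leftDividesˡ; \\-leftDividesʳ)
  open IsGroup isGroup using (_\\_)

  private instance
    d-nonZero : NonZero d
    d-nonZero = Finₚ.nonZeroIndex (FinGroup.ε G)

  left-translation : Fin d → Permutation d d
  left-translation σ = permutation (σ ∙_) (σ \\_) (\\-leftDividesˡ σ) (\\-leftDividesʳ σ)

  sumFin≡sum : (f : Fin k → Fin N) → sumFin _⊕_ 0# k f ≡ sum f
  sumFin≡sum {zero}  f = refl
  sumFin≡sum {suc k} f = cong (f zero ⊕_) (sumFin≡sum (f ∘ suc))

  mulN≡· : ∀ k x → mulN _⊕_ 0# k x ≡ k · x
  mulN≡· zero    x = refl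
  mulN≡· (suc k) x = cong (x ⊕_) (mulN≡· k x)

  sumFin-mulN≡sum-· : (c : Fin k → ℕ) (g : Fin k → Fin N) →
    sumFin _⊕_ 0# k (λ i → mulN _⊕_ 0# (c i) (g i)) ≡ sum (λ i → c i · g i)
  sumFin-mulN≡sum-· c g =
    trans (sumFin≡sum (λ i → mulN _⊕_ 0# (c i) (g i))) (sum-cong-≗ (λ i → mulN≡· (c i) (g i)))

  ν≡sum : ∀ x → ν x ≡ sum (λ σ → act σ x)
  ν≡sum x = sumFin≡sum (λ σ → act σ x)

  ν-hom : IsHom ν
  ν-hom x y = begin
    ν (x ⊕ y)                                           ≡⟨ ν≡sum (x ⊕ y) ⟩
    sum (λ σ → act σ (x ⊕ y))                           ≡⟨ sum-cong-≗ (λ σ → act-+ σ x y) ⟩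
    sum (λ σ → act σ x ⊕ act σ y)                       ≡⟨ ∑-distrib-+ (λ σ → act σ x) (λ σ → act σ y) ⟩
    sum (λ σ → act σ x) ⊕ sum (λ σ → act σ y)           ≡⟨ cong₂ _⊕_ (ν≡sum x) (ν≡sum y) ⟨
    ν x ⊕ ν y                                           ∎
    where open ≡-Reasoning

  act-ν : ∀ σ x → act σ (ν x) ≡ ν x
  act-ν σ x = begin
    act σ (ν x)                        ≡⟨ cong (act σ) (ν≡sum x) ⟩
    act σ (sum (λ τ → act τ x))        ≡⟨ hom-sum (act-+ σ) (λ τ → act τ x) ⟩
    sum (λ τ → act σ (act τ x))        ≡⟨ sum-cong-≗ (λ τ → act-∙ σ τ x) ⟨
    sum (λ τ → act (σ ∙ τ) x)          ≡⟨ sum-permute (λ τ → act τ x) (left-translation σ) ⟨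
    sum (λ τ → act τ x)                ≡⟨ ν≡sum x ⟨
    ν x                                ∎
    where open ≡-Reasoning

  ν∘ν : ∀ x → ν (ν x) ≡ d · ν x
  ν∘ν x = trans (ν≡sum (ν x)) (trans (sum-cong-≗ (λ σ → act-ν σ x)) (sum-replicate d))

  ν̄≡d·-ν : ∀ x → ν̄ x ≡ d · x - ν x
  ν̄≡d·-ν x = begin
    ν̄ x                                        ≡⟨ sumFin≡sum (λ σ → x - act σ x) ⟩
    sum (λ σ → x - act σ x)                    ≡⟨ ∑-distrib-+ {d} (λ _ → x) (λ σ → ⊖ act σ x) ⟩
    sum {d} (λ _ → x) ⊕ sum (λ σ → ⊖ act σ x)  ≡⟨ cong₂ _⊕_ (sym (sum-replicate d)) (hom-sum ⊖-hom (λ σ → act σ x)) ⟨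
    d · x - sum (λ σ → act σ x)                ≡⟨ cong (d · x -_) (ν≡sum x) ⟨
    d · x - ν x                                ∎
    where open ≡-Reasoning

  ν̄-hom : IsHom ν̄
  ν̄-hom = IsHom-≗ (difference-hom (·-hom d) ν-hom) (sym ∘ ν̄≡d·-ν)

  ν∘ν̄ : ∀ x → ν (ν̄ x) ≡ 0#
  ν∘ν̄ x = begin
    ν (ν̄ x)                    ≡⟨ cong ν (ν̄≡d·-ν x) ⟩
    ν (d · x - ν x)            ≡⟨ ν-hom (d · x) (⊖ ν x) ⟩
    ν (d · x) ⊕ ν (⊖ ν x)      ≡⟨ cong₂ _⊕_ (hom-· ν-hom d x) (hom-⊖ ν-hom (ν x)) ⟩
    d · ν x - ν (ν x)          ≡⟨ cong (d · ν x -_) (ν∘ν x) ⟩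
    d · ν x - d · ν x          ≡⟨ inverseʳ (d · ν x) ⟩
    0#                         ∎
    where open ≡-Reasoning

  ν̄∘ν : ∀ x → ν̄ (ν x) ≡ 0#
  ν̄∘ν x = trans (ν̄≡d·-ν (ν x)) (trans (cong (d · ν x -_) (ν∘ν x)) (inverseʳ (d · ν x)))

  d-Ker-ν⊆Im-ν̄ : ∀ {x} → ν x ≡ 0# → ∃ λ y → ν̄ y ≡ d · x
  d-Ker-ν⊆Im-ν̄ {x} νx≡0 = x , trans (ν̄≡d·-ν x) (trans (cong (λ z → d · x ⊕ ⊖ z) νx≡0)
                                           (trans (cong (d · x ⊕_) ε⁻¹≈ε) (identityʳ (d · x))))

  d-Ker-ν̄⊆Im-ν : ∀ {x} → ν̄ x ≡ 0# → ∃ λ y → ν y ≡ d · x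
  d-Ker-ν̄⊆Im-ν {x} ν̄x≡0 = x , sym (x∙y⁻¹≈ε⇒x≈y (d · x) (ν x) (trans (sym (ν̄≡d·-ν x)) ν̄x≡0))

  module _ {r : ℕ} (generated : GeneratedBy r) where

    count-torsion≤d^r : count (ker? (d ·_)) ℕ.≤ d ^ r
    count-torsion≤d^r = count-torsion≤d^#generators d gens λ x →
      let (c , c-combination≡x) = proj₂ generated x in
      c , trans (sym (sumFin-mulN≡sum-· c gens)) c-combination≡x
      where gens = proj₁ generated

    kerCard≡imCard*bounded : ∀ {α β} → IsHom α → IsHom β → (∀ x → β (α x) ≡ 0#) →
      (∀ {x} → β x ≡ 0# → ∃ λ y → α y ≡ d · x) →
      ∃ λ q → kerCard β ≡ imCard α * q × q ℕ.≤ d ^ r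
    kerCard≡imCard*bounded {α} {β} α-hom β-hom β∘α≡0 d-Ker⊆Im
      with ker-im-index≤torsion d α-hom β-hom β∘α≡0 d-Ker⊆Im
    ... | q , ker≡im*q , q≤torsion =
        q
      , trans (length-filter-allFin (ker? β))
              (trans ker≡im*q (cong (_* q) (sym (length-filter-allFin (image? α)))))
      , ℕₚ.≤-trans q≤torsion count-torsion≤d^r

mainTheorem4 : (ℓ : ℕ) → Prime ℓ → (d : ℕ) → (G : FinGroup d) →
    (M : ℕ → FinModule ℓ d G) →
    (∃ λ r → ∀ n → FinModule.GeneratedBy (M n) r) →
    ((λ n → FinModule.kerCard (M n) (FinModule.ν (M n)))
       ∼⟨ ℓ ⟩ (λ n → FinModule.imCard (M n) (FinModule.ν̄ (M n))))
    × ((λ n → FinModule.kerCard (M n) (FinModule.ν̄ (M n)))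
       ∼⟨ ℓ ⟩ (λ n → FinModule.imCard (M n) (FinModule.ν (M n))))
mainTheorem4 ℓ ℓ-prime d G M (r , generated) =
    ∼-of-bounded-cofactor (d ^ r) (λ n → let open GModule (M n) in
      kerCard≡imCard*bounded (generated n) ν̄-hom ν-hom ν∘ν̄ d-Ker-ν⊆Im-ν̄)
  , ∼-of-bounded-cofactor (d ^ r) (λ n → let open GModule (M n) in
      kerCard≡imCard*bounded (generated n) ν-hom ν̄-hom ν̄∘ν d-Ker-ν̄⊆Im-ν)
  where open Valuation ℓ-prime
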